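{- Let $(T,f)$ be a recursive Borel code. Then there is $a_T\in\mathcal O$ such that $B(T,f)\leq_m\mathsf{id}^{+a_T}$.
   Context: $\phi_e$ is the $e$-th partial computable function; $\langle\cdot,\cdot\rangle$ the standard pairing; $\mathsf{id}$ the identity relation on $\mathbb N$. A recursive Borel code is a pair $(T,f)$ where $T$ is a computable well-founded tree on $\mathbb N$ such that for every non-terminal node $t$ and every $n$, $t^\frown n\in T$, and $f$ is a computable function from the terminal nodes of $T$ to $\mathbb N$. Define $B_t$ by recursion on $t\in T$: if $t$ is terminal, $B_t=\operatorname{ran}\phi_{f(t)}$; otherwise $B_t=\{n:\forall p\,\exists q\ n\in B_{t^\frown\langle p,q\rangle}\}$; and $B(T,f)=B_\emptyset$. The computable FS-jump of an equivalence relation $E$ on $\mathbb N$ is $E^+$ with $e\mathrel{E^+}e'$ iff $\{[\phi_e(n)]_E:\phi_e(n)\downarrow\}=\{[\phi_{e'}(n)]_E:\phi_{e'}(n)\downarrow\}$. Kleene's $\mathcal O$: $1\in\mathcal O$; $b\in\mathcal O\Rightarrow 2^b\in\mathcal O$; if $\phi_e$ is total with values in $\mathcal O$ increasing in the $\mathcal O$-order then $3\cdot5^e\in\mathcal O$. Iterates: $E^{+1}=E$, $E^{+2^b}=(E^{+b})^+$, $E^{+3\cdot5^e}=\{(\langle m,x\rangle,\langle n,y\rangle):m=n,\ x\mathrel{E^{+\phi_e(m)}}y\}$. For a set $B\subseteq\mathbb N$ and an equivalence relation $E$ on $\mathbb N$ (viewed as a set of pairs), $B\leq_m E$ means there is a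 computable map $n\mapsto(x_n,y_n)$ with $n\in B\iff x_n\mathrel{E}y_n$. -}

module Defs where

open import Data.Nat using (ℕ; zero; suc; _+_; _*_; _^_; _<_)
open import Data.Product using (Σ; Σ-syntax; _×_; _,_; proj₁; proj₂)
open import Data.Sum using (_⊎_)
open import Data.List using (List; []; _∷_; _∷ʳ_)
open import Relation.Nullary using (¬_)
open import Relation.Binary.PropositionalEquality using (_≡_)
open import Induction.WellFounded using (WellFounded)
open import Function.Bundles using (_⇔_)

tri : ℕ → ℕ
tri zero    = zero
tri (suc n) = suc n + tri n

⟨_,_⟩ : ℕ → ℕ → ℕ
⟨ a , b ⟩ = tri (a + b) + b

-- An acceptable Gödel numbering of the unary partial computable
-- functions.  Programs are unary μ-recursive terms over pairing
-- (a Turing-complete basis); program number e = 8 * k + tag.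
--   tag 0 : constant 0            (k arbitrary)
--   tag 1 : successor             (k arbitrary)
--   tag 2 : first projection  ⟨a,b⟩ ↦ a
--   tag 3 : second projection ⟨a,b⟩ ↦ b
--   tag 4 : composition  k = ⟨f,g⟩ :  x ↦ φ_f (φ_g x)
--   tag 5 : pairing      k = ⟨f,g⟩ :  x ↦ ⟨φ_f x , φ_g x⟩
--   tag 6 : prim. rec.   k = ⟨f,g⟩ :  h⟨x,0⟩ = φ_f x,
--                          h⟨x,y+1⟩ = φ_g ⟨x,⟨y,h⟨x,y⟩⟩⟩
--   tag 7 : minimisation k = f :  x ↦ least y with φ_f⟨x,y⟩ = 0 and
--                          φ_f⟨x,i⟩ defined and nonzero for i < y
-- Eval e x v  means  φ_e(x) ↓ = v.

data Eval : ℕ → ℕ → ℕ → Set where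
  ev-zero  : ∀ {k x} → Eval (8 * k) x 0
  ev-suc   : ∀ {k x} → Eval (8 * k + 1) x (suc x)
  ev-left  : ∀ {k a b} → Eval (8 * k + 2) ⟨ a , b ⟩ a
  ev-right : ∀ {k a b} → Eval (8 * k + 3) ⟨ a , b ⟩ b
  ev-comp  : ∀ {f g x y z} → Eval g x y → Eval f y z →
             Eval (8 * ⟨ f , g ⟩ + 4) x z
  ev-pair  : ∀ {f g x y z} → Eval f x y → Eval g x z →
             Eval (8 * ⟨ f , g ⟩ + 5) x ⟨ y , z ⟩
  ev-rec0  : ∀ {f g x y} → Eval f x y →
             Eval (8 * ⟨ f , g ⟩ + 6) ⟨ x , 0 ⟩ y
  ev-recS  : ∀ {f g x y z w} →
             Eval (8 * ⟨ f , g ⟩ + 6) ⟨ x , y ⟩ z →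
             Eval g ⟨ x , ⟨ y , z ⟩ ⟩ w →
             Eval (8 * ⟨ f , g ⟩ + 6) ⟨ x , suc y ⟩ w
  ev-mu    : ∀ {f x y} → Eval f ⟨ x , y ⟩ 0 →
             (∀ i → i < y → Σ[ v ∈ ℕ ] Eval f ⟨ x , i ⟩ (suc v)) →
             Eval (8 * f + 7) x y

_↓_ : ℕ → ℕ → Set
e ↓ x = Σ[ v ∈ ℕ ] Eval e x v

Total : ℕ → Set
Total e = ∀ x → e ↓ x

Rel : Set₁
Rel = ℕ → ℕ → Set

idRel : Rel
idRel = _≡_

-- computable FS-jump:  e E⁺ e'  iff
--   {[φ_e(n)]_E : φ_e(n)↓} = {[φ_e'(n)]_E : φ_e'(n)↓}
Jump : Rel → Rel
Jump E e e' =
  (∀ n v → Eval e n v → Σ[ n' ∈ ℕ ] Σ[ v' ∈ ℕ ] (Eval e' n' v' × E v v')) ×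
  (∀ n' v' → Eval e' n' v' → Σ[ n ∈ ℕ ] Σ[ v ∈ ℕ ] (Eval e n v × E v v'))

data O : ℕ → Set
data _<O_ : ℕ → ℕ → Set

data O where
  O-one : O 1
  O-suc : ∀ {b} → O b → O (2 ^ b)
  O-lim : ∀ {e} → (tot : ∀ m → Σ[ v ∈ ℕ ] (Eval e m v × O v)) →
          (∀ m v w → Eval e m v → Eval e (suc m) w → v <O w) →
          O (3 * 5 ^ e)

data _<O_ where
  <O-suc   : ∀ {b} → O b → b <O (2 ^ b)
  <O-lim   : ∀ {e n v} → O (3 * 5 ^ e) → Eval e n v → v <O (3 * 5 ^ e)
  <O-trans : ∀ {a b c} → a <O b → b <O c → a <O c

iter : Rel → {a : ℕ} → O a → Rel
iter E O-one = E
iter E (O-suc p) = Jump (iter E p)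
iter E (O-lim tot inc) x y =
  Σ[ m ∈ ℕ ] Σ[ x' ∈ ℕ ] Σ[ y' ∈ ℕ ]
    (x ≡ ⟨ m , x' ⟩ × y ≡ ⟨ m , y' ⟩ ×
     iter E (proj₂ (proj₂ (tot m))) x' y')

_≤m_ : (ℕ → Set) → Rel → Set
B ≤m E = Σ[ e ∈ ℕ ] ∀ n → Σ[ x ∈ ℕ ] Σ[ y ∈ ℕ ]
           (Eval e n ⟨ x , y ⟩ × (B n ⇔ E x y))

code : List ℕ → ℕ
code []      = 0
code (x ∷ s) = suc ⟨ x , code s ⟩

record BorelCode : Set where
  field
    eT : ℕ   -- index of the characteristic function of T
    eF : ℕ
  _∈T : List ℕ → Set
  s ∈T = Eval eT (code s) 0
  Child : List ℕ → List ℕ → Set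
  Child s t = Σ[ x ∈ ℕ ] (s ≡ t ∷ʳ x × s ∈T)
  Terminal : List ℕ → Set
  Terminal t = ∀ x → ¬ ((t ∷ʳ x) ∈T)
  field
    T-computable : ∀ s → Eval eT (code s) 0 ⊎ Eval eT (code s) 1
    T-root       : [] ∈T
    T-prefix     : ∀ s x → (s ∷ʳ x) ∈T → s ∈T
    T-full       : ∀ t → t ∈T → ¬ Terminal t → ∀ n → (t ∷ʳ n) ∈T
    T-wf         : WellFounded Child
    f-total      : ∀ t → t ∈T → Terminal t → eF ↓ code t

  -- n ∈ B_t (least solution of the recursion; unique since T is well-founded)
  data InB : List ℕ → ℕ → Set where
    B-term    : ∀ {t n c k} → t ∈T → Terminal t →
                Eval eF (code t) c → Eval c k n → InB t n
    B-nonterm : ∀ {t n} → t ∈T → ¬ Terminal t →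
                (∀ p → Σ[ q ∈ ℕ ] InB (t ∷ʳ ⟨ p , q ⟩) n) → InB t n

  B : ℕ → Set
  B = InB []

-- Kleene's recursion theorem gives two programs defined by effective transfinite recursion on T.
-- For a node t and b ∈ O, Notation⟨t, b⟩ is a notation a >_O b and Red⟨t, n⟩ = ⟨x, y⟩ with
-- n ∈ B_t ⇔ x id^{+a} y.  At a leaf, a = 2^b, x is the constant 0 and y outputs 0 iff
-- n ∈ ran φ_{f(t)}, so x E⁺ y iff n ∈ B_t for every reflexive E.  At an inner node the children's
-- notations a_k are chained (a_{k+1} is built above a_k), e enumerates them, and a = 2^2^(3·5^e);
-- with L = id^{+3·5^e} and ⟨x_k, y_k⟩ the children's reductions, row p s enumerates
-- ⟨⟨p,q⟩, x_pq⟩ and ⟨⟨p,q⟩, y_pq⟩ for all q, except that for q + 1 = s the latter is x_pq too.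
-- Then row p 0 L⁺ row p (q+1) iff x_pq ~ y_pq, whence {row p s} L⁺⁺ {row p (q+1)} iff
-- ∀ p ∃ q n ∈ B_{t⌢⟨p,q⟩}, i.e. iff n ∈ B_t.  Well-foundedness of T makes everything converge.

module Submission where

open import Defs
open import Data.Nat
open import Data.Nat.Properties
open import Data.Nat.GeneralisedArithmetic using (fold; iterate; iterate-is-fold)
open import Data.Nat.Tactic.RingSolver using (solve-∀)
open import Data.List using (List; []; _∷_; _∷ʳ_; _ʳ++_; reverse; length)
open import Data.List.Properties using (reverse-++; reverse-involutive)
open import Data.Product using (Σ; Σ-syntax; _×_; _,_; proj₁; proj₂)
open import Data.Sum using (_⊎_; inj₁; inj₂)
open import Data.Empty using (⊥; ⊥-elim)
open import Relation.Nullary using (¬_; yes; no)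
open import Relation.Nullary.Decidable using (True; toWitness)
open import Relation.Binary.PropositionalEquality
open import Relation.Binary.Definitions using (tri<; tri≈; tri>)
open import Function.Bundles using (_⇔_; mk⇔; Equivalence)
open import Function.Construct.Composition using (_⇔-∘_)
open import Function.Construct.Symmetry using (⇔-sym)
open import Induction.WellFounded using (Acc; acc)

tri-mono-≤ : ∀ {s s'} → s ≤ s' → tri s ≤ tri s'
tri-mono-≤ z≤n       = z≤n
tri-mono-≤ (s≤s s≤s') = +-mono-≤ (s≤s s≤s') (tri-mono-≤ s≤s')

tri+≤-<-tri-suc : ∀ {s b} → b ≤ s → tri s + b < tri (suc s)
tri+≤-<-tri-suc {s} {b} b≤s = begin-strict
  tri s + b        ≤⟨ +-monoʳ-≤ (tri s) b≤s ⟩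
  tri s + s        <⟨ n<1+n _ ⟩
  suc (tri s + s)  ≡⟨ cong suc (+-comm (tri s) s) ⟩
  tri (suc s)      ∎
  where open ≤-Reasoning

⟨,⟩-mono-< : ∀ {a b a' b'} → a + b < a' + b' → ⟨ a , b ⟩ < ⟨ a' , b' ⟩
⟨,⟩-mono-< {a} {b} {a'} {b'} lt = begin-strict
  tri (a + b) + b    <⟨ tri+≤-<-tri-suc (m≤n+m b a) ⟩
  tri (suc (a + b))  ≤⟨ tri-mono-≤ lt ⟩
  tri (a' + b')      ≤⟨ m≤m+n _ b' ⟩
  tri (a' + b') + b' ∎
  where open ≤-Reasoning

⟨,⟩-injective : ∀ {a b a' b'} → ⟨ a , b ⟩ ≡ ⟨ a' , b' ⟩ → a ≡ a' × b ≡ b'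
⟨,⟩-injective {a} {b} {a'} {b'} eq with <-cmp (a + b) (a' + b')
... | tri< lt _ _ = ⊥-elim (<-irrefl eq (⟨,⟩-mono-< {a} {b} {a'} {b'} lt))
... | tri> _ _ gt = ⊥-elim (<-irrefl (sym eq) (⟨,⟩-mono-< {a'} {b'} {a} {b} gt))
... | tri≈ _ s≡s' _ = a≡a' , b≡b'
  where
  b≡b' : b ≡ b'
  b≡b' = +-cancelˡ-≡ (tri (a + b)) b b' (trans eq (cong (λ s → tri s + b') (sym s≡s')))
  a≡a' : a ≡ a'
  a≡a' = +-cancelʳ-≡ b a a' (trans s≡s' (cong (a' +_) (sym b≡b')))

⟨,⟩-surjective : ∀ n → Σ[ a ∈ ℕ ] Σ[ b ∈ ℕ ] n ≡ ⟨ a , b ⟩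
⟨,⟩-surjective zero = 0 , 0 , refl
⟨,⟩-surjective (suc n) with ⟨,⟩-surjective n
... | zero  , b , refl = suc b , 0 , next-diagonal b
  where
  next-diagonal : ∀ b → suc ⟨ 0 , b ⟩ ≡ ⟨ suc b , 0 ⟩
  next-diagonal b rewrite +-identityʳ b | +-identityʳ (b + tri b) =
    trans (sym (+-suc (tri b) b)) (+-comm (tri b) (suc b))
... | suc a , b , refl = a , suc b , along-diagonal a b
  where
  along-diagonal : ∀ a b → suc ⟨ suc a , b ⟩ ≡ ⟨ a , suc b ⟩
  along-diagonal a b rewrite +-suc a b = sym (+-suc (tri (suc (a + b))) b)

tag<8 : ∀ i → {True (i <? 8)} → i < 8
tag<8 i {i<8} = toWitness i<8

8*+tag-mono-< : ∀ {a b i j} → a < b → i < 8 → 8 * a + i < 8 * b + j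
8*+tag-mono-< {a} {b} {i} {j} a<b i<8 = begin-strict
  8 * a + i  <⟨ +-monoʳ-< (8 * a) i<8 ⟩
  8 * a + 8  ≡⟨ +-comm (8 * a) 8 ⟩
  8 + 8 * a  ≡⟨ *-suc 8 a ⟨
  8 * suc a  ≤⟨ *-monoʳ-≤ 8 a<b ⟩
  8 * b      ≤⟨ m≤m+n (8 * b) j ⟩
  8 * b + j  ∎
  where open ≤-Reasoning

8*+tag-injective : ∀ {a b i j} → i < 8 → j < 8 → 8 * a + i ≡ 8 * b + j → a ≡ b × i ≡ j
8*+tag-injective {a} {b} i<8 j<8 eq with <-cmp a b
... | tri< a<b _ _ = ⊥-elim (<-irrefl eq (8*+tag-mono-< a<b i<8))
... | tri> _ _ b<a = ⊥-elim (<-irrefl (sym eq) (8*+tag-mono-< b<a j<8))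
... | tri≈ _ refl _ = refl , +-cancelˡ-≡ (8 * a) _ _ eq

LastRule : ℕ → ℕ → ℕ → ℕ → Set
LastRule 0 k x v = v ≡ 0
LastRule 1 k x v = v ≡ suc x
LastRule 2 k x v = Σ[ a ∈ ℕ ] Σ[ b ∈ ℕ ] (x ≡ ⟨ a , b ⟩ × v ≡ a)
LastRule 3 k x v = Σ[ a ∈ ℕ ] Σ[ b ∈ ℕ ] (x ≡ ⟨ a , b ⟩ × v ≡ b)
LastRule 4 k x v = Σ[ f ∈ ℕ ] Σ[ g ∈ ℕ ] (k ≡ ⟨ f , g ⟩ × Σ[ y ∈ ℕ ] (Eval g x y × Eval f y v))
LastRule 5 k x v = Σ[ f ∈ ℕ ] Σ[ g ∈ ℕ ] (k ≡ ⟨ f , g ⟩ ×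
  Σ[ y ∈ ℕ ] Σ[ z ∈ ℕ ] (Eval f x y × Eval g x z × v ≡ ⟨ y , z ⟩))
LastRule 6 k x v = Σ[ f ∈ ℕ ] Σ[ g ∈ ℕ ] (k ≡ ⟨ f , g ⟩ × Σ[ a ∈ ℕ ]
  ((x ≡ ⟨ a , 0 ⟩ × Eval f a v) ⊎
   Σ[ y ∈ ℕ ] Σ[ z ∈ ℕ ] (x ≡ ⟨ a , suc y ⟩ × Eval (8 * k + 6) ⟨ a , y ⟩ z ×
                          Eval g ⟨ a , ⟨ y , z ⟩ ⟩ v)))
LastRule 7 k x v = Eval k ⟨ x , v ⟩ 0 × (∀ i → i < v → Σ[ w ∈ ℕ ] Eval k ⟨ x , i ⟩ (suc w))
LastRule _ k x v = ⊥

lastRule : ∀ {e x v} k i → i < 8 → e ≡ 8 * k + i → Eval e x v → LastRule i k x v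
lastRule k i i<8 eq (ev-zero {k'})
  with refl , refl ← 8*+tag-injective {k'} {k} (tag<8 0) i<8 (trans (+-identityʳ (8 * k')) eq) = refl
lastRule k i i<8 eq (ev-suc {k'})
  with refl , refl ← 8*+tag-injective {k'} {k} (tag<8 1) i<8 eq = refl
lastRule k i i<8 eq (ev-left {k'} {a} {b})
  with refl , refl ← 8*+tag-injective {k'} {k} (tag<8 2) i<8 eq = a , b , refl , refl
lastRule k i i<8 eq (ev-right {k'} {a} {b})
  with refl , refl ← 8*+tag-injective {k'} {k} (tag<8 3) i<8 eq = a , b , refl , refl
lastRule k i i<8 eq (ev-comp {f} {g} dg df)
  with refl , refl ← 8*+tag-injective {⟨ f , g ⟩} {k} (tag<8 4) i<8 eq = f , g , refl , _ , dg , df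
lastRule k i i<8 eq (ev-pair {f} {g} df dg)
  with refl , refl ← 8*+tag-injective {⟨ f , g ⟩} {k} (tag<8 5) i<8 eq =
    f , g , refl , _ , _ , df , dg , refl
lastRule k i i<8 eq (ev-rec0 {f} {g} {x} df)
  with refl , refl ← 8*+tag-injective {⟨ f , g ⟩} {k} (tag<8 6) i<8 eq =
    f , g , refl , x , inj₁ (refl , df)
lastRule k i i<8 eq (ev-recS {f} {g} {x} {y} dh dg)
  with refl , refl ← 8*+tag-injective {⟨ f , g ⟩} {k} (tag<8 6) i<8 eq =
    f , g , refl , x , inj₂ (y , _ , refl , dh , dg)
lastRule k i i<8 eq (ev-mu {f} d0 below)
  with refl , refl ← 8*+tag-injective {f} {k} (tag<8 7) i<8 eq = d0 , below

Eval-deterministic : ∀ {e x v w} → Eval e x v → Eval e x w → v ≡ w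
Eval-deterministic (ev-zero {k}) d = sym (lastRule k 0 (tag<8 0) (sym (+-identityʳ (8 * k))) d)
Eval-deterministic (ev-suc {k}) d = sym (lastRule k 1 (tag<8 1) refl d)
Eval-deterministic (ev-left {k} {a} {b}) d
  with a' , b' , eq , refl ← lastRule k 2 (tag<8 2) refl d =
    proj₁ (⟨,⟩-injective {a} {b} {a'} {b'} eq)
Eval-deterministic (ev-right {k} {a} {b}) d
  with a' , b' , eq , refl ← lastRule k 3 (tag<8 3) refl d =
    proj₂ (⟨,⟩-injective {a} {b} {a'} {b'} eq)
Eval-deterministic (ev-comp {f} {g} dg df) d
  with f' , g' , eq , _ , dg' , df' ← lastRule ⟨ f , g ⟩ 4 (tag<8 4) refl d
  with refl , refl ← ⟨,⟩-injective {f} {g} {f'} {g'} eq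
  with refl ← Eval-deterministic dg dg' = Eval-deterministic df df'
Eval-deterministic (ev-pair {f} {g} df dg) d
  with f' , g' , eq , _ , _ , df' , dg' , refl ← lastRule ⟨ f , g ⟩ 5 (tag<8 5) refl d
  with refl , refl ← ⟨,⟩-injective {f} {g} {f'} {g'} eq
  with refl ← Eval-deterministic df df' | refl ← Eval-deterministic dg dg' = refl
Eval-deterministic (ev-rec0 {f} {g} {x} df) d with lastRule ⟨ f , g ⟩ 6 (tag<8 6) refl d
... | f' , g' , eq , a , inj₁ (eqx , df')
  with refl , refl ← ⟨,⟩-injective {f} {g} {f'} {g'} eq
  with refl , _ ← ⟨,⟩-injective {x} {0} {a} {0} eqx = Eval-deterministic df df'
... | _ , _ , _ , a , inj₂ (y , _ , eqx , _) with () ← proj₂ (⟨,⟩-injective {x} {0} {a} {suc y} eqx)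
Eval-deterministic (ev-recS {f} {g} {x} {y} dh dg) d with lastRule ⟨ f , g ⟩ 6 (tag<8 6) refl d
... | _ , _ , _ , a , inj₁ (eqx , _) with () ← proj₂ (⟨,⟩-injective {x} {suc y} {a} {0} eqx)
... | f' , g' , eq , a , inj₂ (y' , _ , eqx , dh' , dg')
  with refl , refl ← ⟨,⟩-injective {f} {g} {f'} {g'} eq
  with refl , refl ← ⟨,⟩-injective {x} {suc y} {a} {suc y'} eqx
  with refl ← Eval-deterministic dh dh' = Eval-deterministic dg dg'
Eval-deterministic (ev-mu {f} {x} {y} d0 below) d
  with d0' , below' ← lastRule f 7 (tag<8 7) refl d
  with <-cmp y _
... | tri≈ _ eq _ = eq
... | tri< lt _ _ with () ← Eval-deterministic d0 (proj₂ (below' y lt))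
... | tri> _ _ gt with () ← Eval-deterministic (proj₂ (below _ gt)) d0'

Z S π₁ π₂ : ℕ
Z  = 0
S  = 1
π₁ = 2
π₂ = 3

infixr 9 _∙_

-- Opaque copies of the pairing and of the program formers: unification then treats
-- ⟪ a , b ⟫ and f ∙ g as rigid instead of unfolding them into arithmetic.
opaque
  ⟪_,_⟫ : ℕ → ℕ → ℕ
  ⟪ a , b ⟫ = ⟨ a , b ⟩

  ⟪⟫≡⟨⟩ : ∀ a b → ⟪ a , b ⟫ ≡ ⟨ a , b ⟩
  ⟪⟫≡⟨⟩ a b = refl

  ⟪⟫-injective : ∀ {a b a' b'} → ⟪ a , b ⟫ ≡ ⟪ a' , b' ⟫ → a ≡ a' × b ≡ b'
  ⟪⟫-injective {a} {b} {a'} {b'} = ⟨,⟩-injective {a} {b} {a'} {b'}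

  ⟪⟫-surjective : ∀ n → Σ[ a ∈ ℕ ] Σ[ b ∈ ℕ ] n ≡ ⟪ a , b ⟫
  ⟪⟫-surjective = ⟨,⟩-surjective

  _∙_ fork rec : ℕ → ℕ → ℕ
  f ∙ g    = 8 * ⟨ f , g ⟩ + 4
  fork f g = 8 * ⟨ f , g ⟩ + 5
  rec f g  = 8 * ⟨ f , g ⟩ + 6

  mu : ℕ → ℕ
  mu f = 8 * f + 7

  ∙-code : ∀ f g → f ∙ g ≡ 8 * ⟪ f , g ⟫ + 4
  ∙-code f g = refl

  fork-code : ∀ f g → fork f g ≡ 8 * ⟪ f , g ⟫ + 5
  fork-code f g = refl

  rec-code : ∀ f g → rec f g ≡ 8 * ⟪ f , g ⟫ + 6
  rec-code f g = refl

  ⇓π₁ : ∀ {a b} → Eval π₁ ⟪ a , b ⟫ a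
  ⇓π₁ {a} {b} = ev-left {0} {a} {b}

  ⇓π₂ : ∀ {a b} → Eval π₂ ⟪ a , b ⟫ b
  ⇓π₂ {a} {b} = ev-right {0} {a} {b}

  ⇓∙ : ∀ {f g x y z} → Eval g x y → Eval f y z → Eval (f ∙ g) x z
  ⇓∙ {f} {g} {x} {y} {z} = ev-comp {f} {g} {x} {y} {z}

  ⇓fork : ∀ {f g x y z} → Eval f x y → Eval g x z → Eval (fork f g) x ⟪ y , z ⟫
  ⇓fork {f} {g} {x} {y} {z} = ev-pair {f} {g} {x} {y} {z}

  ⇓rec₀ : ∀ {f g x y} → Eval f x y → Eval (rec f g) ⟪ x , 0 ⟫ y
  ⇓rec₀ {f} {g} {x} {y} = ev-rec0 {f} {g} {x} {y}

  ⇓recₛ : ∀ {f g x y z w} → Eval (rec f g) ⟪ x , y ⟫ z → Eval g ⟪ x , ⟪ y , z ⟫ ⟫ w →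
          Eval (rec f g) ⟪ x , suc y ⟫ w
  ⇓recₛ {f} {g} {x} {y} {z} {w} = ev-recS {f} {g} {x} {y} {z} {w}

  ⇓mu : ∀ {f x y} → Eval f ⟪ x , y ⟫ 0 →
        (∀ i → i < y → Σ[ v ∈ ℕ ] Eval f ⟪ x , i ⟫ (suc v)) → Eval (mu f) x y
  ⇓mu {f} {x} {y} = ev-mu {f} {x} {y}

  ⇓∙-inv : ∀ {f g x z} → Eval (f ∙ g) x z → Σ[ y ∈ ℕ ] (Eval g x y × Eval f y z)
  ⇓∙-inv {f} {g} d
    with f' , g' , eq , y , dg , df ← lastRule ⟨ f , g ⟩ 4 (tag<8 4) refl d
    with refl , refl ← ⟨,⟩-injective {f} {g} {f'} {g'} eq = y , dg , df

  ⇓fork-inv : ∀ {f g x v} → Eval (fork f g) x v →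
              Σ[ y ∈ ℕ ] Σ[ z ∈ ℕ ] (Eval f x y × Eval g x z × v ≡ ⟪ y , z ⟫)
  ⇓fork-inv {f} {g} d
    with f' , g' , eq , y , z , df , dg , v≡ ← lastRule ⟨ f , g ⟩ 5 (tag<8 5) refl d
    with refl , refl ← ⟨,⟩-injective {f} {g} {f'} {g'} eq = y , z , df , dg , v≡

  ⇓mu-inv : ∀ {f x y} → Eval (mu f) x y → Eval f ⟪ x , y ⟫ 0
  ⇓mu-inv {f} d = proj₁ (lastRule f 7 (tag<8 7) refl d)

I : ℕ
I = fork π₁ π₂

K : ℕ → ℕ
K zero    = Z
K (suc n) = S ∙ K n

π₂² : ℕ
π₂² = π₂ ∙ π₂

Curry : ℕ → ℕ → ℕ
Curry u v = u ∙ fork (K v) I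

⇓Z : ∀ {x} → Eval Z x 0
⇓Z {x} = ev-zero {0} {x}

⇓S : ∀ {x} → Eval S x (suc x)
⇓S {x} = ev-suc {0} {x}

⇓I : ∀ {x} → Eval I x x
⇓I {x} with a , b , refl ← ⟪⟫-surjective x = ⇓fork ⇓π₁ ⇓π₂

⇓K : ∀ n {x} → Eval (K n) x n
⇓K zero    = ⇓Z
⇓K (suc n) = ⇓∙ (⇓K n) ⇓S

⇓π₂² : ∀ {a b c} → Eval π₂² ⟪ a , ⟪ b , c ⟫ ⟫ c
⇓π₂² = ⇓∙ ⇓π₂ ⇓π₂

⇓Curry : ∀ {u v x y} → Eval u ⟪ v , x ⟫ y → Eval (Curry u v) x y
⇓Curry = ⇓∙ (⇓fork (⇓K _) ⇓I)

Add : ℕ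
Add = rec I (S ∙ π₂²)

⇓Add : ∀ a b → Eval Add ⟪ a , b ⟫ (a + b)
⇓Add a zero    = subst (Eval Add ⟪ a , 0 ⟫) (sym (+-identityʳ a)) (⇓rec₀ ⇓I)
⇓Add a (suc b) =
  subst (Eval Add ⟪ a , suc b ⟫) (sym (+-suc a b)) (⇓recₛ (⇓Add a b) (⇓∙ ⇓π₂² ⇓S))

Pred : ℕ
Pred = Curry (rec Z (π₁ ∙ π₂)) 0

⇓Pred : ∀ n → Eval Pred n (pred n)
⇓Pred n = ⇓Curry (go n)
  where
  go : ∀ n → Eval (rec Z (π₁ ∙ π₂)) ⟪ 0 , n ⟫ (pred n)
  go zero    = ⇓rec₀ ⇓Z
  go (suc n) = ⇓recₛ (go n) (⇓∙ ⇓π₂ ⇓π₁)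

Monus : ℕ
Monus = rec I (Pred ∙ π₂²)

⇓Monus : ∀ a b → Eval Monus ⟪ a , b ⟫ (a ∸ b)
⇓Monus a zero    = ⇓rec₀ ⇓I
⇓Monus a (suc b) rewrite sym (pred[m∸n]≡m∸[1+n] a b) =
  ⇓recₛ (⇓Monus a b) (⇓∙ ⇓π₂² (⇓Pred _))

dist : ℕ → ℕ → ℕ
dist a b = (a ∸ b) + (b ∸ a)

dist≡0⇒≡ : ∀ {a b} → dist a b ≡ 0 → a ≡ b
dist≡0⇒≡ {a} {b} eq =
  ≤-antisym (m∸n≡0⇒m≤n (m+n≡0⇒m≡0 (a ∸ b) eq)) (m∸n≡0⇒m≤n (m+n≡0⇒n≡0 (a ∸ b) eq))

dist-self : ∀ a → dist a a ≡ 0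
dist-self a rewrite n∸n≡0 a = refl

Dist : ℕ
Dist = Add ∙ fork Monus (Monus ∙ fork π₂ π₁)

⇓Dist : ∀ a b → Eval Dist ⟪ a , b ⟫ (dist a b)
⇓Dist a b = ⇓∙ (⇓fork (⇓Monus a b) (⇓∙ (⇓fork ⇓π₂ ⇓π₁) (⇓Monus b a))) (⇓Add _ _)

select : ℕ → ℕ → ℕ → ℕ
select a b zero    = a
select a b (suc _) = b

Select : ℕ
Select = rec π₁ (π₂ ∙ π₁)

⇓Select : ∀ a b c → Eval Select ⟪ ⟪ a , b ⟫ , c ⟫ (select a b c)
⇓Select a b zero    = ⇓rec₀ ⇓π₁
⇓Select a b (suc c) = ⇓recₛ (⇓Select a b c) (⇓∙ ⇓π₁ ⇓π₂)

Pow2 : ℕ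
Pow2 = Curry (rec (K 1) (Add ∙ fork π₂² π₂²)) 0

⇓Pow2 : ∀ b → Eval Pow2 b (2 ^ b)
⇓Pow2 b = ⇓Curry (go b)
  where
  go : ∀ b → Eval (rec (K 1) (Add ∙ fork π₂² π₂²)) ⟪ 0 , b ⟫ (2 ^ b)
  go zero    = ⇓rec₀ (⇓K 1)
  go (suc b) = subst (Eval _ _) (cong (2 ^ b +_) (sym (+-identityʳ (2 ^ b))))
                     (⇓recₛ (go b) (⇓∙ (⇓fork ⇓π₂² ⇓π₂²) (⇓Add _ _)))

Times5 : ℕ
Times5 = Add ∙ fork I (Add ∙ fork I (Add ∙ fork I (Add ∙ fork I I)))

⇓Times5 : ∀ m → Eval Times5 m (5 * m)
⇓Times5 m = subst (Eval Times5 m) (five-fold m)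
  (⇓∙ (⇓fork ⇓I (⇓∙ (⇓fork ⇓I (⇓∙ (⇓fork ⇓I (⇓∙ (⇓fork ⇓I ⇓I) (⇓Add _ _))) (⇓Add _ _))) (⇓Add _ _)))
      (⇓Add _ _))
  where
  five-fold : ∀ m → m + (m + (m + (m + m))) ≡ 5 * m
  five-fold = solve-∀

Lim : ℕ
Lim = Curry (rec (K 3) (Times5 ∙ π₂²)) 0

⇓Lim : ∀ e → Eval Lim e (3 * 5 ^ e)
⇓Lim e = ⇓Curry (go e)
  where
  go : ∀ e → Eval (rec (K 3) (Times5 ∙ π₂²)) ⟪ 0 , e ⟫ (3 * 5 ^ e)
  go zero    = ⇓rec₀ (⇓K 3)
  go (suc e) = subst (Eval _ _) (lemma (5 ^ e)) (⇓recₛ (go e) (⇓∙ ⇓π₂² (⇓Times5 _)))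
    where
    lemma : ∀ m → 5 * (3 * m) ≡ 3 * (5 * m)
    lemma = solve-∀

AddConst : ℕ → ℕ
AddConst zero    = I
AddConst (suc k) = S ∙ AddConst k

⇓AddConst : ∀ k {x} → Eval (AddConst k) x (k + x)
⇓AddConst zero    = ⇓I
⇓AddConst (suc k) = ⇓∙ (⇓AddConst k) ⇓S

Times8 : ℕ
Times8 = Curry (rec Z (AddConst 8 ∙ π₂²)) 0

⇓Times8 : ∀ z → Eval Times8 z (8 * z)
⇓Times8 z = ⇓Curry (go z)
  where
  go : ∀ y → Eval (rec Z (AddConst 8 ∙ π₂²)) ⟪ 0 , y ⟫ (8 * y)
  go zero    = ⇓rec₀ ⇓Z
  go (suc y) = subst (Eval _ _) (sym (*-suc 8 y)) (⇓recₛ (go y) (⇓∙ ⇓π₂² (⇓AddConst 8)))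

Tag : ℕ → ℕ
Tag i = AddConst i ∙ Times8

⇓Tag : ∀ i z → Eval (Tag i) z (8 * z + i)
⇓Tag i z = subst (Eval (Tag i) z) (+-comm i (8 * z)) (⇓∙ (⇓Times8 z) (⇓AddConst i))

Make∙ MakeFork MakeRec : ℕ
Make∙    = Tag 4
MakeFork = Tag 5
MakeRec  = Tag 6

⇓Make∙ : ∀ f g → Eval Make∙ ⟪ f , g ⟫ (f ∙ g)
⇓Make∙ f g = subst (Eval Make∙ ⟪ f , g ⟫) (sym (∙-code f g)) (⇓Tag 4 _)

⇓MakeFork : ∀ f g → Eval MakeFork ⟪ f , g ⟫ (fork f g)
⇓MakeFork f g = subst (Eval MakeFork ⟪ f , g ⟫) (sym (fork-code f g)) (⇓Tag 5 _)

⇓MakeRec : ∀ f g → Eval MakeRec ⟪ f , g ⟫ (rec f g)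
⇓MakeRec f g = subst (Eval MakeRec ⟪ f , g ⟫) (sym (rec-code f g)) (⇓Tag 6 _)

MakeK : ℕ
MakeK = Curry (rec Z (Make∙ ∙ fork (K 1) π₂²)) 0

⇓MakeK : ∀ n → Eval MakeK n (K n)
⇓MakeK n = ⇓Curry (go n)
  where
  go : ∀ n → Eval (rec Z (Make∙ ∙ fork (K 1) π₂²)) ⟪ 0 , n ⟫ (K n)
  go zero    = ⇓rec₀ ⇓Z
  go (suc n) = ⇓recₛ (go n) (⇓∙ (⇓fork (⇓K 1) ⇓π₂²) (⇓Make∙ _ _))

MakeCurry : ℕ
MakeCurry = Make∙ ∙ fork π₁ (MakeFork ∙ fork (MakeK ∙ π₂) (K I))

⇓MakeCurry : ∀ u v → Eval MakeCurry ⟪ u , v ⟫ (Curry u v)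
⇓MakeCurry u v = ⇓∙ (⇓fork ⇓π₁ (⇓∙ (⇓fork (⇓∙ ⇓π₂ (⇓MakeK v)) (⇓K I)) (⇓MakeFork _ _))) (⇓Make∙ _ _)

diag : ℕ → ℕ
diag u = u ∙ fork I (K u)

Diag : ℕ
Diag = Make∙ ∙ fork I (MakeFork ∙ fork (K I) MakeK)

⇓Diag : ∀ u → Eval Diag u (diag u)
⇓Diag u = ⇓∙ (⇓fork ⇓I (⇓∙ (⇓fork (⇓K I) (⇓MakeK u)) (⇓MakeFork _ _))) (⇓Make∙ _ _)

fix : ℕ → ℕ
fix g = diag (g ∙ fork π₁ (Diag ∙ π₂))

⇓fix : ∀ {g x v} → Eval g ⟪ x , fix g ⟫ v → Eval (fix g) x v
⇓fix d = ⇓∙ (⇓fork ⇓I (⇓K _)) (⇓∙ (⇓fork ⇓π₁ (⇓∙ ⇓π₂ (⇓Diag _))) d)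

Iterate : ℕ → ℕ
Iterate s = rec I (s ∙ π₂²)

⇓Iterate : ∀ {A : Set} (enc : A → ℕ) {p} {f : A → A} → (∀ s → Eval p (enc s) (enc (f s))) →
           ∀ s m → Eval (Iterate p) ⟪ enc s , m ⟫ (enc (fold s f m))
⇓Iterate enc step s zero    = ⇓rec₀ ⇓I
⇓Iterate enc step s (suc m) = ⇓recₛ (⇓Iterate enc step s m) (⇓∙ ⇓π₂² (step _))

code-∷ : ∀ x s → code (x ∷ s) ≡ suc ⟪ x , code s ⟫
code-∷ x s = cong suc (sym (⟪⟫≡⟨⟩ x (code s)))

code≥length : ∀ l → length l ≤ code l
code≥length []      = z≤n
code≥length (x ∷ l) = s≤s (≤-trans (code≥length l) (m≤n+m (code l) (tri (x + code l))))

State : Set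
State = List ℕ × List ℕ

encState : State → ℕ
encState (l , a) = ⟪ code l , code a ⟫

revStep : State → State
revStep ([] , a)    = [] , a
revStep (x ∷ l , a) = l , x ∷ a

iterate-revStep : ∀ l a m → length l ≤ m → iterate revStep (l , a) m ≡ ([] , l ʳ++ a)
iterate-revStep [] a zero    _ = refl
iterate-revStep [] a (suc m) _ = iterate-revStep [] a m z≤n
iterate-revStep (x ∷ l) a (suc m) (s≤s l≤m) = iterate-revStep l (x ∷ a) m l≤m

Pop : ℕ
Pop = fork (π₂ ∙ Pred ∙ π₁) (S ∙ fork (π₁ ∙ Pred ∙ π₁) π₂)

⇓Pop : ∀ {x c a} → Eval Pop ⟪ suc ⟪ x , c ⟫ , a ⟫ ⟪ c , suc ⟪ x , a ⟫ ⟫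
⇓Pop = ⇓fork (⇓∙ (⇓∙ ⇓π₁ (⇓Pred _)) ⇓π₂) (⇓∙ (⇓fork (⇓∙ (⇓∙ ⇓π₁ (⇓Pred _)) ⇓π₁) ⇓π₂) ⇓S)

⇓Pop-[] : ∀ {a} → Eval Pop ⟪ 0 , a ⟫ ⟪ 0 , suc ⟪ 0 , a ⟫ ⟫
⇓Pop-[] = ⇓fork (⇓∙ (⇓∙ ⇓π₁ (⇓Pred _)) π₂-0) (⇓∙ (⇓fork (⇓∙ (⇓∙ ⇓π₁ (⇓Pred _)) π₁-0) ⇓π₂) ⇓S)
  where
  π₁-0 : Eval π₁ 0 0
  π₁-0 = subst (λ z → Eval π₁ z 0) (⟪⟫≡⟨⟩ 0 0) ⇓π₁
  π₂-0 : Eval π₂ 0 0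
  π₂-0 = subst (λ z → Eval π₂ z 0) (⟪⟫≡⟨⟩ 0 0) ⇓π₂

RevStep : ℕ
RevStep = Select ∙ fork (fork I Pop) π₁

⇓RevStep : ∀ s → Eval RevStep (encState s) (encState (revStep s))
⇓RevStep ([] , a) = ⇓∙ (⇓fork (⇓fork ⇓I ⇓Pop-[]) ⇓π₁) (⇓Select _ _ 0)
⇓RevStep (x ∷ l , a) rewrite code-∷ x l | code-∷ x a =
  ⇓∙ (⇓fork (⇓fork ⇓I ⇓Pop) ⇓π₁) (⇓Select _ _ (suc _))

Reverse : ℕ
Reverse = π₂ ∙ Iterate RevStep ∙ fork (fork I Z) I

⇓Reverse : ∀ l → Eval Reverse (code l) (code (reverse l))
⇓Reverse l = ⇓∙ (⇓∙ (⇓fork (⇓fork ⇓I ⇓Z) ⇓I) iterated) ⇓π₂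
  where
  done : fold (l , []) revStep (code l) ≡ ([] , reverse l)
  done = trans (iterate-is-fold _ revStep (code l)) (iterate-revStep l [] (code l) (code≥length l))
  iterated : Eval (Iterate RevStep) ⟪ encState (l , []) , code l ⟫ (encState ([] , reverse l))
  iterated = subst (λ s → Eval (Iterate RevStep) ⟪ encState (l , []) , code l ⟫ (encState s)) done
                   (⇓Iterate encState ⇓RevStep (l , []) (code l))

-- Nodes are passed to programs reversed, so that the children of t are reached by one pairing.
revCode : List ℕ → ℕ
revCode t = code (reverse t)

revCode-∷ʳ : ∀ t k → revCode (t ∷ʳ k) ≡ suc ⟪ k , revCode t ⟫
revCode-∷ʳ t k = trans (cong code (reverse-++ t (k ∷ []))) (code-∷ k _)

⇓Reverse-revCode : ∀ t → Eval Reverse (revCode t) (code t)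
⇓Reverse-revCode t =
  subst (Eval Reverse (revCode t)) (cong code (reverse-involutive t)) (⇓Reverse (reverse t))

Guard : ℕ
Guard = mu (Dist ∙ π₁)

⇓Guard : ∀ a → Eval Guard ⟪ a , a ⟫ 0
⇓Guard a = ⇓mu (⇓∙ ⇓π₁ (subst (Eval Dist _) (dist-self a) (⇓Dist a a))) (λ i ())

⇓Guard-inv : ∀ {a b v} → Eval Guard ⟪ a , b ⟫ v → a ≡ b × v ≡ 0
⇓Guard-inv {a} {b} {v} d
  with w , dπ₁ , dDist ← ⇓∙-inv (⇓mu-inv d)
  with refl ← Eval-deterministic dπ₁ (⇓π₁ {⟪ a , b ⟫} {v})
  with refl ← dist≡0⇒≡ {a} {b} (Eval-deterministic (⇓Dist a b) dDist)
  = refl , Eval-deterministic d (⇓Guard a)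

rowEntry : ℕ → ℕ → ℕ → ℕ → ℕ → ℕ
rowEntry x y q s j = select x (select x y (dist (suc q) s)) j

rowEntry-x⊎y : ∀ x y q s j → rowEntry x y q s j ≡ x ⊎ rowEntry x y q s j ≡ y
rowEntry-x⊎y x y q s zero = inj₁ refl
rowEntry-x⊎y x y q s (suc j) with dist (suc q) s
... | zero  = inj₁ refl
... | suc _ = inj₂ refl

rowEntry-diagonal : ∀ x y q j → rowEntry x y q (suc q) j ≡ x
rowEntry-diagonal x y q zero    = refl
rowEntry-diagonal x y q (suc j) rewrite dist-self (suc q) = refl

rowEntry-off-diagonal : ∀ x y {q s} j → suc q ≢ s → rowEntry x y q s (suc j) ≡ y
rowEntry-off-diagonal x y {q} {s} j q+1≢s with dist (suc q) s in eq
... | zero  = ⊥-elim (q+1≢s (dist≡0⇒≡ eq))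
... | suc _ = refl

opaque
  ChildQuery : ℕ
  ChildQuery = fork (S ∙ fork (fork (π₂ ∙ π₂ ∙ π₁) (π₁ ∙ π₂)) (π₁ ∙ π₁)) (π₁ ∙ π₂ ∙ π₁)

  ⇓ChildQuery : ∀ {r n p q j} →
                Eval ChildQuery ⟪ ⟪ r , ⟪ n , p ⟫ ⟫ , ⟪ q , j ⟫ ⟫ ⟪ suc ⟪ ⟪ p , q ⟫ , r ⟫ , n ⟫
  ⇓ChildQuery = ⇓fork (⇓∙ (⇓fork (⇓fork (⇓∙ (⇓∙ ⇓π₁ ⇓π₂) ⇓π₂) (⇓∙ ⇓π₂ ⇓π₁)) (⇓∙ ⇓π₁ ⇓π₁)) ⇓S)
                      (⇓∙ (⇓∙ ⇓π₁ ⇓π₂) ⇓π₁)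

  Entry : ℕ
  Entry = fork (fork (π₁ ∙ π₁) (π₁ ∙ π₁ ∙ π₂))
               (Select ∙ fork (fork (π₁ ∙ π₂ ∙ π₂)
                                    (Select ∙ fork (π₂ ∙ π₂) (Dist ∙ fork (S ∙ π₁ ∙ π₁ ∙ π₂) (π₂ ∙ π₁))))
                              (π₂ ∙ π₁ ∙ π₂))

  ⇓Entry : ∀ {p s q j x y} →
           Eval Entry ⟪ ⟪ p , s ⟫ , ⟪ ⟪ q , j ⟫ , ⟪ x , y ⟫ ⟫ ⟫ ⟪ ⟪ p , q ⟫ , rowEntry x y q s j ⟫
  ⇓Entry = ⇓fork (⇓fork (⇓∙ ⇓π₁ ⇓π₁) (⇓∙ (⇓∙ ⇓π₂ ⇓π₁) ⇓π₁))
    (⇓∙ (⇓fork (⇓fork (⇓∙ (⇓∙ ⇓π₂ ⇓π₂) ⇓π₁)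
                      (⇓∙ (⇓fork (⇓∙ ⇓π₂ ⇓π₂)
                                 (⇓∙ (⇓fork (⇓∙ (⇓∙ (⇓∙ ⇓π₂ ⇓π₁) ⇓π₁) ⇓S) (⇓∙ ⇓π₁ ⇓π₂)) (⇓Dist _ _)))
                          (⇓Select _ _ _)))
               (⇓∙ (⇓∙ ⇓π₂ ⇓π₁) ⇓π₂))
        (⇓Select _ _ _))

  row : ℕ → ℕ → ℕ → ℕ → ℕ → ℕ
  row f r n p s = Curry Entry ⟪ p , s ⟫ ∙ fork I (f ∙ Curry ChildQuery ⟪ r , ⟪ n , p ⟫ ⟫)

  ⇓row : ∀ {f r n p s q j x y} → Eval f ⟪ suc ⟪ ⟪ p , q ⟫ , r ⟫ , n ⟫ ⟪ x , y ⟫ →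
         Eval (row f r n p s) ⟪ q , j ⟫ ⟪ ⟪ p , q ⟫ , rowEntry x y q s j ⟫
  ⇓row d = ⇓∙ (⇓fork ⇓I (⇓∙ (⇓Curry ⇓ChildQuery) d)) (⇓Curry ⇓Entry)

  Row ShiftedRow NodeRed : ℕ
  Row = Make∙ ∙ fork (MakeCurry ∙ fork (K Entry) π₂)
          (MakeFork ∙ fork (K I) (Make∙ ∙ fork (π₂ ∙ π₁)
            (MakeCurry ∙ fork (K ChildQuery) (fork (π₁ ∙ π₁ ∙ π₁) (fork (π₂ ∙ π₁ ∙ π₁) (π₁ ∙ π₂))))))
  ShiftedRow = Row ∙ fork π₁ (fork (π₁ ∙ π₂) (S ∙ π₂ ∙ π₂))
  NodeRed = fork (MakeCurry ∙ fork (K Row) I) (MakeCurry ∙ fork (K ShiftedRow) I)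

  ⇓Row : ∀ {f r n p s} → Eval Row ⟪ ⟪ ⟪ r , n ⟫ , f ⟫ , ⟪ p , s ⟫ ⟫ (row f r n p s)
  ⇓Row = ⇓∙ (⇓fork (⇓∙ (⇓fork (⇓K Entry) ⇓π₂) (⇓MakeCurry _ _))
    (⇓∙ (⇓fork (⇓K I) (⇓∙ (⇓fork (⇓∙ ⇓π₁ ⇓π₂)
      (⇓∙ (⇓fork (⇓K ChildQuery)
                 (⇓fork (⇓∙ (⇓∙ ⇓π₁ ⇓π₁) ⇓π₁) (⇓fork (⇓∙ (⇓∙ ⇓π₁ ⇓π₁) ⇓π₂) (⇓∙ ⇓π₂ ⇓π₁))))
          (⇓MakeCurry _ _))) (⇓Make∙ _ _))) (⇓MakeFork _ _)))
    (⇓Make∙ _ _)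

  rows shiftedRows : ℕ → ℕ → ℕ → ℕ
  rows f r n        = Curry Row ⟪ ⟪ r , n ⟫ , f ⟫
  shiftedRows f r n = Curry ShiftedRow ⟪ ⟪ r , n ⟫ , f ⟫

  ⇓rows : ∀ {f r n p s} → Eval (rows f r n) ⟪ p , s ⟫ (row f r n p s)
  ⇓rows = ⇓Curry ⇓Row

  ⇓shiftedRows : ∀ {f r n p q} → Eval (shiftedRows f r n) ⟪ p , q ⟫ (row f r n p (suc q))
  ⇓shiftedRows = ⇓Curry (⇓∙ (⇓fork ⇓π₁ (⇓fork (⇓∙ ⇓π₂ ⇓π₁) (⇓∙ (⇓∙ ⇓π₂ ⇓π₂) ⇓S))) ⇓Row)

  ⇓NodeRed : ∀ {r n f} → Eval NodeRed ⟪ ⟪ r , n ⟫ , f ⟫ ⟪ rows f r n , shiftedRows f r n ⟫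
  ⇓NodeRed = ⇓fork (⇓∙ (⇓fork (⇓K Row) ⇓I) (⇓MakeCurry _ _))
                   (⇓∙ (⇓fork (⇓K ShiftedRow) ⇓I) (⇓MakeCurry _ _))

opaque
  NextChild : ℕ
  NextChild = fork (S ∙ fork (S ∙ π₁ ∙ π₂ ∙ π₂) π₁) (π₂ ∙ π₂ ∙ π₂)

  ⇓NextChild : ∀ {r x m w} → Eval NextChild ⟪ r , ⟪ x , ⟪ m , w ⟫ ⟫ ⟫ ⟪ suc ⟪ suc m , r ⟫ , w ⟫
  ⇓NextChild = ⇓fork (⇓∙ (⇓fork (⇓∙ (⇓∙ (⇓∙ ⇓π₂ ⇓π₂) ⇓π₁) ⇓S) ⇓π₁) ⇓S) (⇓∙ (⇓∙ ⇓π₂ ⇓π₂) ⇓π₂)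

  notationChain : ℕ → ℕ → ℕ → ℕ
  notationChain nf r b = rec (nf ∙ K ⟪ suc ⟪ 0 , r ⟫ , b ⟫) (nf ∙ Curry NextChild r)

  ⇓notationChain₀ : ∀ {nf t b w} → Eval nf ⟪ revCode (t ∷ʳ 0) , b ⟫ w →
                    Eval (notationChain nf (revCode t) b) ⟪ 0 , 0 ⟫ w
  ⇓notationChain₀ {nf} {t} {b} d =
    ⇓rec₀ (⇓∙ (⇓K _) (subst (λ z → Eval nf ⟪ z , b ⟫ _) (revCode-∷ʳ t 0) d))

  ⇓notationChainₛ : ∀ {nf t b m w w'} → Eval (notationChain nf (revCode t) b) ⟪ 0 , m ⟫ w →
                    Eval nf ⟪ revCode (t ∷ʳ suc m) , w ⟫ w' →
                    Eval (notationChain nf (revCode t) b) ⟪ 0 , suc m ⟫ w'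
  ⇓notationChainₛ {nf} {t} {m = m} {w} d d' =
    ⇓recₛ d (⇓∙ (⇓Curry ⇓NextChild)
                (subst (λ z → Eval nf ⟪ z , w ⟫ _) (revCode-∷ʳ t (suc m)) d'))

  childNotations : ℕ → ℕ → ℕ → ℕ
  childNotations nf r b = Curry (notationChain nf r b) 0

  ⇓childNotations : ∀ {nf r b m w} → Eval (notationChain nf r b) ⟪ 0 , m ⟫ w →
                    Eval (childNotations nf r b) m w
  ⇓childNotations = ⇓Curry

  ChildNotations NodeNotation LeafNotation : ℕ
  ChildNotations =
    Make∙ ∙ fork (MakeRec ∙ fork (Make∙ ∙ fork π₂ (MakeK ∙ fork (S ∙ fork Z (π₁ ∙ π₁)) (π₂ ∙ π₁)))
                                 (Make∙ ∙ fork π₂ (MakeCurry ∙ fork (K NextChild) (π₁ ∙ π₁))))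
                 (K (fork Z I))
  NodeNotation = Pow2 ∙ Pow2 ∙ Lim ∙ ChildNotations
  LeafNotation = Pow2 ∙ π₂ ∙ π₁

  ⇓ChildNotations : ∀ {r b nf} → Eval ChildNotations ⟪ ⟪ r , b ⟫ , nf ⟫ (childNotations nf r b)
  ⇓ChildNotations =
    ⇓∙ (⇓fork (⇓∙ (⇓fork (⇓∙ (⇓fork ⇓π₂
                                    (⇓∙ (⇓fork (⇓∙ (⇓fork ⇓Z (⇓∙ ⇓π₁ ⇓π₁)) ⇓S) (⇓∙ ⇓π₁ ⇓π₂)) (⇓MakeK _)))
                                  (⇓Make∙ _ _))
                              (⇓∙ (⇓fork ⇓π₂ (⇓∙ (⇓fork (⇓K NextChild) (⇓∙ ⇓π₁ ⇓π₁)) (⇓MakeCurry _ _)))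
                                  (⇓Make∙ _ _)))
                  (⇓MakeRec _ _))
              (⇓K (fork Z I)))
       (⇓Make∙ _ _)

  ⇓NodeNotation : ∀ {r b nf} →
                  Eval NodeNotation ⟪ ⟪ r , b ⟫ , nf ⟫ (2 ^ (2 ^ (3 * 5 ^ childNotations nf r b)))
  ⇓NodeNotation = ⇓∙ (⇓∙ (⇓∙ ⇓ChildNotations (⇓Lim _)) (⇓Pow2 _)) (⇓Pow2 _)

  ⇓LeafNotation : ∀ {r b nf} → Eval LeafNotation ⟪ ⟪ r , b ⟫ , nf ⟫ (2 ^ b)
  ⇓LeafNotation = ⇓∙ (⇓∙ ⇓π₁ ⇓π₂) (⇓Pow2 _)

leafTarget : ℕ → ℕ → ℕ
leafTarget c n = Guard ∙ fork c (K n)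

module Construction (eT eF : ℕ) where

  opaque
    -- t is terminal iff t ∷ʳ 0 ∉ T, since T is full below its non-terminal nodes.
    LeafTest : ℕ
    LeafTest = eT ∙ Reverse ∙ S ∙ fork Z (π₁ ∙ π₁)

    ⇓LeafTest : ∀ {t n f c} → Eval eT (code (t ∷ʳ 0)) c → Eval LeafTest ⟪ ⟪ revCode t , n ⟫ , f ⟫ c
    ⇓LeafTest {t} d =
      ⇓∙ (⇓∙ (⇓∙ (⇓fork ⇓Z (⇓∙ ⇓π₁ ⇓π₁)) (subst (Eval S _) (sym (revCode-∷ʳ t 0)) ⇓S))
             (⇓Reverse-revCode (t ∷ʳ 0)))
         d

    -- rec evaluates the node branch first, so it must converge at leaves as well.
    ByLeaf : ℕ → ℕ → ℕ
    ByLeaf A B = rec A (B ∙ π₁) ∙ fork I LeafTest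

    ⇓ByLeaf-node : ∀ {A B t n f v} → Eval eT (code (t ∷ʳ 0)) 0 →
                   Eval A ⟪ ⟪ revCode t , n ⟫ , f ⟫ v → Eval (ByLeaf A B) ⟪ ⟪ revCode t , n ⟫ , f ⟫ v
    ⇓ByLeaf-node d dA = ⇓∙ (⇓fork ⇓I (⇓LeafTest d)) (⇓rec₀ dA)

    ⇓ByLeaf-leaf : ∀ {A B t n f u v} → Eval eT (code (t ∷ʳ 0)) 1 → Eval A ⟪ ⟪ revCode t , n ⟫ , f ⟫ u →
                   Eval B ⟪ ⟪ revCode t , n ⟫ , f ⟫ v → Eval (ByLeaf A B) ⟪ ⟪ revCode t , n ⟫ , f ⟫ v
    ⇓ByLeaf-leaf d dA dB = ⇓∙ (⇓fork ⇓I (⇓LeafTest d)) (⇓recₛ (⇓rec₀ dA) (⇓∙ ⇓π₁ dB))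

    LeafRed : ℕ
    LeafRed = fork Z (Make∙ ∙ fork (K Guard) (MakeFork ∙ fork (eF ∙ Reverse ∙ π₁ ∙ π₁) (MakeK ∙ π₂ ∙ π₁)))

    ⇓LeafRed : ∀ {t n f c} → Eval eF (code t) c →
               Eval LeafRed ⟪ ⟪ revCode t , n ⟫ , f ⟫ ⟪ Z , leafTarget c n ⟫
    ⇓LeafRed {t} {n} d =
      ⇓fork ⇓Z (⇓∙ (⇓fork (⇓K Guard) (⇓∙ (⇓fork (⇓∙ (⇓∙ (⇓∙ ⇓π₁ ⇓π₁) (⇓Reverse-revCode t)) d)
                                              (⇓∙ (⇓∙ ⇓π₁ ⇓π₂) (⇓MakeK n)))
                                        (⇓MakeFork _ _)))
                   (⇓Make∙ _ _))

  Red Notation : ℕ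
  Red      = fix (ByLeaf NodeRed LeafRed)
  Notation = fix (ByLeaf NodeNotation LeafNotation)

  ⇓Red-node : ∀ {t n} → Eval eT (code (t ∷ʳ 0)) 0 →
              Eval Red ⟪ revCode t , n ⟫ ⟪ rows Red (revCode t) n , shiftedRows Red (revCode t) n ⟫
  ⇓Red-node d = ⇓fix (⇓ByLeaf-node d ⇓NodeRed)

  ⇓Red-leaf : ∀ {t n c} → Eval eT (code (t ∷ʳ 0)) 1 → Eval eF (code t) c →
              Eval Red ⟪ revCode t , n ⟫ ⟪ Z , leafTarget c n ⟫
  ⇓Red-leaf d dc = ⇓fix (⇓ByLeaf-leaf d ⇓NodeRed (⇓LeafRed dc))

  ⇓Notation-node : ∀ {t b} → Eval eT (code (t ∷ʳ 0)) 0 →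
                   Eval Notation ⟪ revCode t , b ⟫ (2 ^ (2 ^ (3 * 5 ^ childNotations Notation (revCode t) b)))
  ⇓Notation-node d = ⇓fix (⇓ByLeaf-node d ⇓NodeNotation)

  ⇓Notation-leaf : ∀ {t b} → Eval eT (code (t ∷ʳ 0)) 1 → Eval Notation ⟪ revCode t , b ⟫ (2 ^ b)
  ⇓Notation-leaf d = ⇓fix (⇓ByLeaf-leaf d ⇓NodeNotation ⇓LeafNotation)

Jump-refl : ∀ {E : Rel} → (∀ x → E x x) → ∀ e → Jump E e e
Jump-refl E-refl e = (λ n v d → n , v , d , E-refl v) , (λ n v d → n , v , d , E-refl v)

Jump-sym : ∀ {E : Rel} → (∀ {x y} → E x y → E y x) → ∀ {e e'} → Jump E e e' → Jump E e' e
Jump-sym E-sym (forth , back) =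
  (λ n v d → let n' , v' , d' , e = back n v d in n' , v' , d' , E-sym e) ,
  (λ n v d → let n' , v' , d' , e = forth n v d in n' , v' , d' , E-sym e)

SumRel : (ℕ → Rel) → Rel
SumRel E x y = Σ[ m ∈ ℕ ] Σ[ x' ∈ ℕ ] Σ[ y' ∈ ℕ ] (x ≡ ⟨ m , x' ⟩ × y ≡ ⟨ m , y' ⟩ × E m x' y')

SumRel-refl : ∀ {E : ℕ → Rel} → (∀ m x → E m x x) → ∀ x → SumRel E x x
SumRel-refl E-refl x with m , x' , refl ← ⟨,⟩-surjective x = m , x' , x' , refl , refl , E-refl m x'

SumRel-sym : ∀ {E : ℕ → Rel} → (∀ m {x y} → E m x y → E m y x) →
             ∀ {x y} → SumRel E x y → SumRel E y x
SumRel-sym E-sym (m , x' , y' , x≡ , y≡ , e) = m , y' , x' , y≡ , x≡ , E-sym m e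

SumRel-intro : ∀ {E : ℕ → Rel} {m a a'} → E m a a' → SumRel E ⟪ m , a ⟫ ⟪ m , a' ⟫
SumRel-intro {m = m} {a} {a'} e = m , a , a' , ⟪⟫≡⟨⟩ m a , ⟪⟫≡⟨⟩ m a' , e

SumRel-elim : ∀ {E : ℕ → Rel} {m a m' a'} → SumRel E ⟪ m , a ⟫ ⟪ m' , a' ⟫ → m ≡ m' × E m a a'
SumRel-elim {m = m} {a} {m'} {a'} (k , x' , y' , x≡ , y≡ , e)
  with refl , refl ← ⟨,⟩-injective {m} {a} {k} {x'} (trans (sym (⟪⟫≡⟨⟩ m a)) x≡)
     | refl , refl ← ⟨,⟩-injective {m'} {a'} {k} {y'} (trans (sym (⟪⟫≡⟨⟩ m' a')) y≡) =
    refl , e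

iter-refl : ∀ {a} (p : O a) x → iter idRel p x x
iter-refl O-one           x = refl
iter-refl (O-suc p)       x = Jump-refl (iter-refl p) x
iter-refl (O-lim tot inc) x = SumRel-refl (λ m → iter-refl (proj₂ (proj₂ (tot m)))) x

iter-sym : ∀ {a} (p : O a) {x y} → iter idRel p x y → iter idRel p y x
iter-sym O-one           e = sym e
iter-sym (O-suc p)       e = Jump-sym (iter-sym p) e
iter-sym (O-lim tot inc) e = SumRel-sym (λ m → iter-sym (proj₂ (proj₂ (tot m)))) e

leafTarget-reduces : ∀ {E : Rel} → (∀ x → E x x) → ∀ c n →
                     (Σ[ k ∈ ℕ ] Eval c k n) ⇔ Jump E Z (leafTarget c n)
leafTarget-reduces {E} E-refl c n = mk⇔ to from
  where
  outputs-0 : ∀ {k v} → Eval (leafTarget c n) k v → Eval c k n × v ≡ 0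
  outputs-0 d
    with _ , dfork , dGuard ← ⇓∙-inv d
    with _ , _ , dc , dK , refl ← ⇓fork-inv dfork
    with refl ← Eval-deterministic dK (⇓K n)
    with refl , v≡0 ← ⇓Guard-inv dGuard = dc , v≡0

  to : Σ[ k ∈ ℕ ] Eval c k n → Jump E Z (leafTarget c n)
  to (k , dc) =
    (λ _ v dZ → k , 0 , ⇓∙ (⇓fork dc (⇓K n)) (⇓Guard n) ,
                subst (λ v → E v 0) (Eval-deterministic ⇓Z dZ) (E-refl 0)) ,
    (λ _ v d → 0 , 0 , ⇓Z , subst (E 0) (sym (proj₂ (outputs-0 d))) (E-refl 0))

  from : Jump E Z (leafTarget c n) → Σ[ k ∈ ℕ ] Eval c k n
  from (forth , _) = let k , _ , d , _ = forth 0 0 ⇓Z in k , proj₁ (outputs-0 d)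

module RowReduction {f r n : ℕ} (E : ℕ → Rel) (E-refl : ∀ k x → E k x x)
                    (E-sym : ∀ k {x y} → E k x y → E k y x) (x y : ℕ → ℕ)
                    (child : ∀ k → Eval f ⟪ suc ⟪ k , r ⟫ , n ⟫ ⟪ x k , y k ⟫) where

  private
    L : Rel
    L = SumRel E

    L-reflexive : ∀ {k w w'} → w ≡ w' → L ⟪ k , w ⟫ ⟪ k , w' ⟫
    L-reflexive refl = SumRel-intro (E-refl _ _)

    entry : ℕ → ℕ → ℕ → ℕ → ℕ
    entry p s q j = ⟪ ⟪ p , q ⟫ , rowEntry (x ⟪ p , q ⟫) (y ⟪ p , q ⟫) q s j ⟫

    ⇓entry : ∀ p s q j → Eval (row f r n p s) ⟪ q , j ⟫ (entry p s q j)
    ⇓entry p s q j = ⇓row (child ⟪ p , q ⟫)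

    ⇓row-inv : ∀ {p s z v} → Eval (row f r n p s) z v →
               Σ[ q ∈ ℕ ] Σ[ j ∈ ℕ ] (z ≡ ⟪ q , j ⟫ × v ≡ entry p s q j)
    ⇓row-inv {p} {s} {z} d with q , j , refl ← ⟪⟫-surjective z =
      q , j , refl , Eval-deterministic d (⇓entry p s q j)

    ⇓rows-inv : ∀ {z v} → Eval (rows f r n) z v →
                Σ[ p ∈ ℕ ] Σ[ s ∈ ℕ ] (z ≡ ⟪ p , s ⟫ × v ≡ row f r n p s)
    ⇓rows-inv {z} d with p , s , refl ← ⟪⟫-surjective z = p , s , refl , Eval-deterministic d ⇓rows

    ⇓shiftedRows-inv : ∀ {z v} → Eval (shiftedRows f r n) z v →
                       Σ[ p ∈ ℕ ] Σ[ q ∈ ℕ ] (z ≡ ⟪ p , q ⟫ × v ≡ row f r n p (suc q))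
    ⇓shiftedRows-inv {z} d with p , q , refl ← ⟪⟫-surjective z =
      p , q , refl , Eval-deterministic d ⇓shiftedRows

    Jump-L-refl : ∀ e → Jump L e e
    Jump-L-refl = Jump-refl (SumRel-refl E-refl)

  -- row p (suc q) differs from row p 0 only in that the entries of index q are all x_pq.
  row-similar : ∀ {p q} → E ⟪ p , q ⟫ (x ⟪ p , q ⟫) (y ⟪ p , q ⟫) →
                Jump L (row f r n p 0) (row f r n p (suc q))
  row-similar {p} {q} e = forth , back
    where
    forth : ∀ z v → Eval (row f r n p 0) z v →
            Σ[ z' ∈ ℕ ] Σ[ v' ∈ ℕ ] (Eval (row f r n p (suc q)) z' v' × L v v')
    forth z v d with ⇓row-inv d
    ... | q' , zero  , refl , refl = ⟪ q' , 0 ⟫ , _ , ⇓entry p (suc q) q' 0 , L-reflexive refl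
    ... | q' , suc j , refl , refl with q' ≟ q
    ...   | yes refl = ⟪ q , 0 ⟫ , _ , ⇓entry p (suc q) q 0 , SumRel-intro (E-sym _ e)
    ...   | no q'≢q  = ⟪ q' , 1 ⟫ , _ , ⇓entry p (suc q) q' 1 ,
                       L-reflexive (sym (rowEntry-off-diagonal _ _ 0 (λ eq → q'≢q (suc-injective eq))))
    back : ∀ z v → Eval (row f r n p (suc q)) z v →
           Σ[ z' ∈ ℕ ] Σ[ v' ∈ ℕ ] (Eval (row f r n p 0) z' v' × L v' v)
    back z v d with q' , j , refl , refl ← ⇓row-inv d
                  with rowEntry-x⊎y (x ⟪ p , q' ⟫) (y ⟪ p , q' ⟫) q' (suc q) j
    ... | inj₁ eq = ⟪ q' , 0 ⟫ , _ , ⇓entry p 0 q' 0 , L-reflexive (sym eq)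
    ... | inj₂ eq = ⟪ q' , 1 ⟫ , _ , ⇓entry p 0 q' 1 , L-reflexive (sym eq)

  -- The entry of index ⟪ q , 1 ⟫ of row p 0 is y_pq; its only possible partner is x_pq.
  row-similar⇒E : ∀ {p p' q} → Jump L (row f r n p 0) (row f r n p' (suc q)) →
                  p ≡ p' × E ⟪ p , q ⟫ (x ⟪ p , q ⟫) (y ⟪ p , q ⟫)
  row-similar⇒E {p} {p'} {q} (forth , _)
    with _ , _ , d , l ← forth ⟪ q , 1 ⟫ _ (⇓entry p 0 q 1)
    with q' , j , refl , refl ← ⇓row-inv d
    with pq≡p'q' , e ← SumRel-elim l
    with refl , refl ← ⟪⟫-injective pq≡p'q' =
      refl , E-sym _ (subst (E ⟪ p , q ⟫ (y ⟪ p , q ⟫)) (rowEntry-diagonal _ _ q j) e)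

  rows-reduces : Jump (Jump L) (rows f r n) (shiftedRows f r n) ⇔
                 (∀ p → Σ[ q ∈ ℕ ] E ⟪ p , q ⟫ (x ⟪ p , q ⟫) (y ⟪ p , q ⟫))
  rows-reduces = mk⇔ to from
    where
    to : Jump (Jump L) (rows f r n) (shiftedRows f r n) →
         ∀ p → Σ[ q ∈ ℕ ] E ⟪ p , q ⟫ (x ⟪ p , q ⟫) (y ⟪ p , q ⟫)
    to (forth , _) p
      with _ , _ , d , similar ← forth ⟪ p , 0 ⟫ _ ⇓rows
      with _ , q , refl , refl ← ⇓shiftedRows-inv d = q , proj₂ (row-similar⇒E similar)
    from : (∀ p → Σ[ q ∈ ℕ ] E ⟪ p , q ⟫ (x ⟪ p , q ⟫) (y ⟪ p , q ⟫)) →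
           Jump (Jump L) (rows f r n) (shiftedRows f r n)
    from h = forth , back
      where
      forth : ∀ z v → Eval (rows f r n) z v →
              Σ[ z' ∈ ℕ ] Σ[ v' ∈ ℕ ] (Eval (shiftedRows f r n) z' v' × Jump L v v')
      forth z v d with ⇓rows-inv d
      ... | p , zero  , refl , refl = let q , e = h p in ⟪ p , q ⟫ , _ , ⇓shiftedRows , row-similar e
      ... | p , suc q , refl , refl = ⟪ p , q ⟫ , _ , ⇓shiftedRows , Jump-L-refl _
      back : ∀ z v → Eval (shiftedRows f r n) z v →
             Σ[ z' ∈ ℕ ] Σ[ v' ∈ ℕ ] (Eval (rows f r n) z' v' × Jump L v' v)
      back z v d with p , q , refl , refl ← ⇓shiftedRows-inv d =
        ⟪ p , suc q ⟫ , _ , ⇓rows , Jump-L-refl _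

∀∃-cong : {A B : ℕ → Set} → (∀ k → A k ⇔ B k) →
          (∀ p → Σ[ q ∈ ℕ ] A ⟨ p , q ⟩) ⇔ (∀ p → Σ[ q ∈ ℕ ] B ⟪ p , q ⟫)
∀∃-cong {A} {B} A⇔B = mk⇔ to from
  where
  to : (∀ p → Σ[ q ∈ ℕ ] A ⟨ p , q ⟩) → ∀ p → Σ[ q ∈ ℕ ] B ⟪ p , q ⟫
  to h p with q , a ← h p = q , Equivalence.to (A⇔B _) (subst A (sym (⟪⟫≡⟨⟩ p q)) a)
  from : (∀ p → Σ[ q ∈ ℕ ] B ⟪ p , q ⟫) → ∀ p → Σ[ q ∈ ℕ ] A ⟨ p , q ⟩
  from h p with q , b ← h p = q , subst A (⟪⟫≡⟨⟩ p q) (Equivalence.from (A⇔B _) b)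

module Verification (C : BorelCode) where

  open BorelCode C
  open Construction eT eF

  excluded⇒Terminal : ∀ {t} → t ∈T → Eval eT (code (t ∷ʳ 0)) 1 → Terminal t
  excluded⇒Terminal {t} t∈T excluded x t∷ʳx∈T
    with () ← Eval-deterministic excluded (T-full t t∈T (λ terminal → terminal x t∷ʳx∈T) 0)

  InB-leaf : ∀ {t n c} → t ∈T → Terminal t → Eval eF (code t) c → InB t n ⇔ (Σ[ k ∈ ℕ ] Eval c k n)
  InB-leaf {t} {n} {c} t∈T terminal dc = mk⇔ to (λ (k , dk) → B-term t∈T terminal dc dk)
    where
    to : InB t n → Σ[ k ∈ ℕ ] Eval c k n
    to (B-term {k = k} _ _ dc' dk) with refl ← Eval-deterministic dc dc' = k , dk
    to (B-nonterm _ nonterminal _) = ⊥-elim (nonterminal terminal)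

  InB-node : ∀ {t n} → t ∈T → ¬ Terminal t → InB t n ⇔ (∀ p → Σ[ q ∈ ℕ ] InB (t ∷ʳ ⟨ p , q ⟩) n)
  InB-node {t} {n} t∈T nonterminal = mk⇔ to (B-nonterm t∈T nonterminal)
    where
    to : InB t n → ∀ p → Σ[ q ∈ ℕ ] InB (t ∷ʳ ⟨ p , q ⟩) n
    to (B-term _ terminal _ _) = ⊥-elim (nonterminal terminal)
    to (B-nonterm _ _ h) = h

  record Reduces (t : List ℕ) (n : ℕ) {a : ℕ} (p : O a) : Set where
    constructor reduction
    field
      left right : ℕ
      ⇓Red       : Eval Red ⟪ revCode t , n ⟫ ⟪ left , right ⟫
      InB⇔iter   : InB t n ⇔ iter idRel p left right

  record NotationFor (t : List ℕ) (b : ℕ) : Set where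
    field
      value     : ℕ
      ⇓Notation : Eval Notation ⟪ revCode t , b ⟫ value
      value∈O   : O value
      base<O    : b <O value
      reduces   : ∀ n → Reduces t n value∈O

  open NotationFor

  leaf-notation : ∀ {t b} → t ∈T → Eval eT (code (t ∷ʳ 0)) 1 → O b → NotationFor t b
  leaf-notation {t} {b} t∈T excluded b∈O = record
    { value     = 2 ^ b
    ; ⇓Notation = ⇓Notation-leaf excluded
    ; value∈O   = O-suc b∈O
    ; base<O    = <O-suc b∈O
    ; reduces   = λ n → reduction Z (leafTarget c n) (⇓Red-leaf excluded dc)
                          (leafTarget-reduces (iter-refl b∈O) c n ⇔-∘ InB-leaf t∈T terminal dc)
    }
    where
    terminal : Terminal t
    terminal = excluded⇒Terminal t∈T excluded
    c : ℕ
    c = proj₁ (f-total t t∈T terminal)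
    dc : Eval eF (code t) c
    dc = proj₂ (f-total t t∈T terminal)

  node-notation : ∀ {t b} → t ∈T → (t ∷ʳ 0) ∈T → (∀ k {a} → O a → NotationFor (t ∷ʳ k) a) → O b →
                  NotationFor t b
  node-notation {t} {b} t∈T included IH b∈O = record
    { value     = 2 ^ (2 ^ (3 * 5 ^ e))
    ; ⇓Notation = ⇓Notation-node included
    ; value∈O   = O-suc (O-suc lim∈O)
    ; base<O    = <O-trans (<O-trans (<O-trans (base<O (child 0)) (<O-lim lim∈O (proj₁ (proj₂ (tot 0)))))
                                     (<O-suc lim∈O))
                           (<O-suc (O-suc lim∈O))
    ; reduces   = λ n → reduction _ _ (⇓Red-node included) (reduces-at n)
    }
    where
    base : ℕ → Σ[ a ∈ ℕ ] O a
    child : ∀ m → NotationFor (t ∷ʳ m) (proj₁ (base m))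
    base zero    = b , b∈O
    base (suc m) = value (child m) , value∈O (child m)
    child m = IH m (proj₂ (base m))

    e : ℕ
    e = childNotations Notation (revCode t) b

    ⇓chain : ∀ m → Eval (notationChain Notation (revCode t) b) ⟪ 0 , m ⟫ (value (child m))
    ⇓chain zero    = ⇓notationChain₀ {t = t} (⇓Notation (child 0))
    ⇓chain (suc m) = ⇓notationChainₛ {t = t} (⇓chain m) (⇓Notation (child (suc m)))

    tot : ∀ m → Σ[ v ∈ ℕ ] (Eval e m v × O v)
    tot m = value (child m) , ⇓childNotations (⇓chain m) , value∈O (child m)

    inc : ∀ m v w → Eval e m v → Eval e (suc m) w → v <O w
    inc m v w dv dw
      with refl ← Eval-deterministic dv (proj₁ (proj₂ (tot m)))
         | refl ← Eval-deterministic dw (proj₁ (proj₂ (tot (suc m)))) = base<O (child (suc m))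

    lim∈O : O (3 * 5 ^ e)
    lim∈O = O-lim tot inc

    nonterminal : ¬ Terminal t
    nonterminal terminal = terminal 0 included

    childReduction : ∀ n k → Reduces (t ∷ʳ k) n (value∈O (child k))
    childReduction n k = reduces (child k) n

    ⇓childReduction : ∀ n k → let open Reduces (childReduction n k) in
                      Eval Red ⟪ suc ⟪ k , revCode t ⟫ , n ⟫ ⟪ left , right ⟫
    ⇓childReduction n k = subst (λ z → Eval Red ⟪ z , n ⟫ ⟪ left , right ⟫) (revCode-∷ʳ t k) ⇓Red
      where open Reduces (childReduction n k)

    module Rows (n : ℕ) = RowReduction {Red} {revCode t} {n}
      (λ k → iter idRel (value∈O (child k))) (λ k → iter-refl (value∈O (child k)))
      (λ k → iter-sym (value∈O (child k)))
      (λ k → Reduces.left (childReduction n k)) (λ k → Reduces.right (childReduction n k))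
      (⇓childReduction n)

    reduces-at : ∀ n → InB t n ⇔
                 iter idRel (O-suc (O-suc lim∈O)) (rows Red (revCode t) n) (shiftedRows Red (revCode t) n)
    reduces-at n = ⇔-sym (Rows.rows-reduces n)
               ⇔-∘ (∀∃-cong (λ k → Reduces.InB⇔iter (childReduction n k))
               ⇔-∘ InB-node t∈T nonterminal)

  notation-for : ∀ t → Acc Child t → t ∈T → ∀ {b} → O b → NotationFor t b
  notation-for t (acc rs) t∈T b∈O with T-computable (t ∷ʳ 0)
  ... | inj₂ excluded = leaf-notation t∈T excluded b∈O
  ... | inj₁ included =
    node-notation t∈T included (λ k → notation-for (t ∷ʳ k) (rs (k , refl , child∈T k)) (child∈T k)) b∈O
    where
    child∈T : ∀ k → (t ∷ʳ k) ∈T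
    child∈T = T-full t t∈T (λ terminal → terminal 0 included)

lemma3p6 : (C : BorelCode) →
    Σ[ a ∈ ℕ ] Σ[ p ∈ O a ] (BorelCode.B C ≤m iter idRel p)
lemma3p6 C = value N , value∈O N , Curry Red 0 , λ n → reduce (reduces N n)
  where
  open BorelCode C
  open Construction eT eF
  open Verification C
  open NotationFor
  N : NotationFor [] 1
  N = notation-for [] (T-wf []) T-root O-one
  reduce : ∀ {n} → Reduces [] n (value∈O N) →
           Σ[ x ∈ ℕ ] Σ[ y ∈ ℕ ] (Eval (Curry Red 0) n ⟨ x , y ⟩ × (B n ⇔ iter idRel (value∈O N) x y))
  reduce (reduction x y d iff) = x , y , subst (Eval _ _) (⟪⟫≡⟨⟩ x y) (⇓Curry d) , iff
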